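{- Let $M$ be a binary matrix whose conflict graph has no edges, and suppose the bipartite graph $G$ on species and characters, with an edge $(s,c)$ whenever $M[s,c]=1$, is connected. Let $P$ be the order on the characters defined by $c\le c'$ iff $M[s,c]\le M[s,c']$ for every species $s$, and let $C_M$ be the set of maximal elements of $P$. Then any two elements $a,b\in C_M$ are adjacent in the adjacency graph of $M$, i.e. there exists a species $s$ with $M[s,a]=M[s,b]=1$.
   Context: Rows of $M$ are species and columns are characters; $M[s,c]=1$ means species $s$ has character $c$. Two characters $c_1,c_2$ are conflicting if the set of pairs $(M[s,c_1],M[s,c_2])$ over all species equals $\{(0,0),(0,1),(1,0),(1,1)\}$; the conflict graph has the characters as vertices and an edge between each pair of conflicting characters. The graph $G$ is the red-black graph of the (unconstrained) extended matrix of $M$, whose edges are exactly the pairs $(s,c)$ with $M[s,c]=1$. The adjacency graph of $M$ has the characters as vertices, with $u,v$ adjacent iff some species is adjacent to both $u$ and $v$ in $G$. -}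

module Defs where

open import Data.Nat using (ℕ)
open import Data.Fin using (Fin)
open import Data.Bool using (Bool; true; false)
open import Data.Empty using (⊥)
open import Data.Sum using (_⊎_; inj₁; inj₂)
open import Data.Product using (∃; _×_; _,_)
open import Relation.Nullary using (¬_)
open import Relation.Binary.PropositionalEquality using (_≡_)
import Data.Bool as B

-- A binary matrix with n species (rows) and m characters (columns).
Matrix : ℕ → ℕ → Set
Matrix n m = Fin n → Fin m → Bool

Conflicting : ∀ {n m} → Matrix n m → Fin m → Fin m → Set
Conflicting M c₁ c₂ =
  (∃ λ s → M s c₁ ≡ false × M s c₂ ≡ false) ×
  (∃ λ s → M s c₁ ≡ false × M s c₂ ≡ true) ×
  (∃ λ s → M s c₁ ≡ true × M s c₂ ≡ false) ×
  (∃ λ s → M s c₁ ≡ true × M s c₂ ≡ true)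

ConflictFree : ∀ {n m} → Matrix n m → Set
ConflictFree {m = m} M = (c₁ c₂ : Fin m) → ¬ Conflicting M c₁ c₂

Vertex : ℕ → ℕ → Set
Vertex n m = Fin n ⊎ Fin m

Edge : ∀ {n m} → Matrix n m → Vertex n m → Vertex n m → Set
Edge M (inj₁ s) (inj₂ c) = M s c ≡ true
Edge M (inj₂ c) (inj₁ s) = M s c ≡ true
Edge M (inj₁ _) (inj₁ _) = ⊥
Edge M (inj₂ _) (inj₂ _) = ⊥

data Path {n m} (M : Matrix n m) : Vertex n m → Vertex n m → Set where
  here  : ∀ {u} → Path M u u
  there : ∀ {u v w} → Edge M u v → Path M v w → Path M u w

Connected : ∀ {n m} → Matrix n m → Set
Connected {n} {m} M = (u v : Vertex n m) → Path M u v

_⊑[_]_ : ∀ {n m} → Fin m → Matrix n m → Fin m → Set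
_⊑[_]_ {n} c M c' = (s : Fin n) → M s c B.≤ M s c'

Maximal : ∀ {n m} → Matrix n m → Fin m → Set
Maximal {m = m} M c = (c' : Fin m) → c ⊑[ M ] c' → c' ⊑[ M ] c

Adjacent : ∀ {n m} → Matrix n m → Fin m → Fin m → Set
Adjacent M a b = ∃ λ s → M s a ≡ true × M s b ≡ true

-- Suppose the maximal characters a and b share no species. For every c sharing
-- a species s with a, conflict-freeness leaves three options: supp a ⊆ supp c
-- (so supp c = supp a by maximality), supp c ⊆ supp a, or supp a ∪ supp c is
-- everything. In the last case supp b ⊆ supp c, so maximality of b puts s in
-- supp b, which is impossible. Hence "species in supp a, characters with
-- support inside supp a" is closed under edges of G; by connectedness it
-- contains b, and b ≠ a occurs in some species, which then also has a.
module Submission where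

open import Defs
open import Data.Fin using (Fin)
open import Data.Fin.Properties using (any?)
open import Data.Bool using (Bool; true; false; _≟_; b≤b; f≤t)
import Data.Bool as B
open import Data.Empty using (⊥-elim)
open import Data.Sum using (_⊎_; inj₁; inj₂)
open import Data.Product using (∃; _×_; _,_)
open import Relation.Nullary using (¬_; Dec; yes; no)
open import Relation.Nullary.Decidable using (_×-dec_)
open import Relation.Binary.PropositionalEquality using (_≡_; refl; ≢-sym)

≤⇒true⇒true : ∀ {x y : Bool} → x B.≤ y → x ≡ true → y ≡ true
≤⇒true⇒true b≤b x≡true = x≡true

true⇒true⇒≤ : ∀ {x y : Bool} → (x ≡ true → y ≡ true) → x B.≤ y
true⇒true⇒≤ {false} {false} _ = b≤b
true⇒true⇒≤ {false} {true}  _ = f≤t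
true⇒true⇒≤ {true}  {true}  _ = b≤b
true⇒true⇒≤ {true}  {false} f with f refl
... | ()

module _ {n m} (M : Matrix n m) where

  _⊆_ : Fin m → Fin m → Set
  c ⊆ c' = ∀ s → M s c ≡ true → M s c' ≡ true

  Covering : Fin m → Fin m → Set
  Covering c c' = ∀ s → M s c ≡ true ⊎ M s c' ≡ true

  ⊑⇒⊆ : ∀ {c c'} → c ⊑[ M ] c' → c ⊆ c'
  ⊑⇒⊆ c⊑c' s = ≤⇒true⇒true (c⊑c' s)

  ⊆⇒⊑ : ∀ {c c'} → c ⊆ c' → c ⊑[ M ] c'
  ⊆⇒⊑ c⊆c' s = true⇒true⇒≤ (c⊆c' s)

  maximal-⊆ : ∀ {a c} → Maximal M a → a ⊆ c → c ⊆ a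
  maximal-⊆ {c = c} max-a a⊆c = ⊑⇒⊆ (max-a c (⊆⇒⊑ a⊆c))

  Occurs : Fin m → Fin m → Bool → Bool → Set
  Occurs c c' x y = ∃ λ s → M s c ≡ x × M s c' ≡ y

  occurs? : ∀ c c' x y → Dec (Occurs c c' x y)
  occurs? c c' x y = any? λ s → (M s c ≟ x) ×-dec (M s c' ≟ y)

  ¬occurs-true-false⇒⊆ : ∀ {c c'} → ¬ Occurs c c' true false → c ⊆ c'
  ¬occurs-true-false⇒⊆ {c} {c'} ¬10 s sc with M s c' in sc'
  ... | true  = refl
  ... | false = ⊥-elim (¬10 (s , sc , sc'))

  ¬occurs-false-false⇒Covering : ∀ {c c'} → ¬ Occurs c c' false false → Covering c c'
  ¬occurs-false-false⇒Covering {c} {c'} ¬00 s with M s c in sc | M s c' in sc'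
  ... | true  | _     = inj₁ refl
  ... | false | true  = inj₂ refl
  ... | false | false = ⊥-elim (¬00 (s , sc , sc'))

  -- Missing one of the four row patterns: (1,0), (0,1) or (0,0), the last
  -- one only after (1,1) is known to occur.
  overlapping-non-conflicting : ∀ {c c'} → ¬ Conflicting M c c' → Adjacent M c c' →
    c ⊆ c' ⊎ c' ⊆ c ⊎ Covering c c'
  overlapping-non-conflicting {c} {c'} ¬conflict c∩c'
    with occurs? c c' true false | occurs? c c' false true | occurs? c c' false false
  ... | no ¬10   | _       | _       = inj₁ (¬occurs-true-false⇒⊆ ¬10)
  ... | yes _    | no ¬01  | _       =
    inj₂ (inj₁ (¬occurs-true-false⇒⊆ λ (s , sc' , sc) → ¬01 (s , sc , sc')))
  ... | yes r₁₀  | yes r₀₁ | yes r₀₀ = ⊥-elim (¬conflict (r₀₀ , r₀₁ , r₁₀ , c∩c'))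
  ... | yes _    | yes _   | no ¬00  = inj₂ (inj₂ (¬occurs-false-false⇒Covering ¬00))

  module Inside (conflictFree : ConflictFree M) {a b : Fin m}
                (max-a : Maximal M a) (max-b : Maximal M b)
                (a∩b≡∅ : ¬ Adjacent M a b) where

    neighbour⊆ : ∀ {c} → Adjacent M a c → c ⊆ a
    neighbour⊆ {c} a∩c@(s , sa , sc)
      with overlapping-non-conflicting (conflictFree a c) a∩c
    ... | inj₁ a⊆c        = maximal-⊆ max-a a⊆c
    ... | inj₂ (inj₁ c⊆a) = c⊆a
    ... | inj₂ (inj₂ a∪c) = ⊥-elim (a∩b≡∅ (s , sa , maximal-⊆ max-b b⊆c s sc))
      where
        b⊆c : b ⊆ c
        b⊆c t tb with a∪c t
        ... | inj₁ ta = ⊥-elim (a∩b≡∅ (t , ta , tb))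
        ... | inj₂ tc = tc

    InsideA : Vertex n m → Set
    InsideA (inj₁ s) = M s a ≡ true
    InsideA (inj₂ c) = c ⊆ a

    Edge-preserves-InsideA : ∀ {u v} → Edge M u v → InsideA u → InsideA v
    Edge-preserves-InsideA {inj₁ s} {inj₂ c} sc sa = neighbour⊆ (s , sa , sc)
    Edge-preserves-InsideA {inj₂ c} {inj₁ s} sc c⊆a = c⊆a s sc
    Edge-preserves-InsideA {inj₁ _} {inj₁ _} ()
    Edge-preserves-InsideA {inj₂ _} {inj₂ _} ()

Path-preserves : ∀ {n m} {M : Matrix n m} (P : Vertex n m → Set) →
  (∀ {u v} → Edge M u v → P u → P v) → ∀ {u v} → Path M u v → P u → P v
Path-preserves P step here        pu = pu
Path-preserves P step (there e p) pu = Path-preserves P step p (step e pu)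

Path⇒occurs : ∀ {n m} {M : Matrix n m} {c c'} → ¬ c ≡ c' →
  Path M (inj₂ c) (inj₂ c') → ∃ λ s → M s c ≡ true
Path⇒occurs c≢c' here                       = ⊥-elim (c≢c' refl)
Path⇒occurs _    (there {v = inj₁ s} sc _) = s , sc
Path⇒occurs _    (there {v = inj₂ _} () _)

lemma4 : ∀ {n m} (M : Matrix n m) → ConflictFree M → Connected M →
    (a b : Fin m) → ¬ a ≡ b → Maximal M a → Maximal M b → Adjacent M a b
lemma4 M conflictFree connected a b a≢b max-a max-b with occurs? M a b true true
... | yes a∩b    = a∩b
... | no a∩b≡∅ with Path⇒occurs (≢-sym a≢b) (connected (inj₂ b) (inj₂ a))
...   | s , sb = s , b⊆a s sb , sb
  where
    open Inside M conflictFree max-a max-b a∩b≡∅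

    b⊆a : _⊆_ M b a
    b⊆a = Path-preserves InsideA Edge-preserves-InsideA (connected (inj₂ a) (inj₂ b)) (λ _ sa → sa)
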